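{- For all formulae $\varphi_1,\dots,\varphi_k,\psi$ of $\mathcal{L}_{\mathsf{D}}$ ($k\in\mathbb{N}$), $$\mathsf{D}(\varphi_1,\dots,\varphi_k;\psi)\ \equiv\ \bigvee_{\chi\in\mathit{DNF}(\{\varphi_1,\dots,\varphi_k\})}[\mathsf{u}](\chi\leftrightarrow\psi),$$ i.e., for every SD-model $W$ and every $w\in W$, the two formulae have the same truth value at $W,w$.
   Context: Fix a countably infinite set $\mathit{PROP}$ of proposition symbols; assignments are maps $w:\mathit{PROP}\to\{0,1\}$; an SD-model is a (possibly empty) set $W$ of assignments. $\mathcal{L}_{\mathsf{D}}$: formulae $\varphi::=p\mid\neg\varphi\mid(\varphi\to\varphi)\mid\mathsf{D}(\varphi_1,\dots,\varphi_k;\psi)$, $p\in\mathit{PROP}$, $k\in\mathbb{N}$; $\wedge,\vee,\leftrightarrow$ usual abbreviations; $\mathsf{C}\psi$ denotes the case $k=0$. Semantics at $w\in W$: $W,w\models p$ iff $w(p)=1$; $\neg,\to$ classical; $W,w\models\mathsf{D}(\varphi_1,\dots,\varphi_k;\psi)$ iff for all $u,v\in W$, if ($W,u\models\varphi_i\Leftrightarrow W,v\models\varphi_i$) for all $i\le k$, then ($W,u\models\psi\Leftrightarrow W,v\models\psi$). $[\mathsf{u}]\varphi:=\varphi\wedge\mathsf{C}\varphi$. $\top:=p\vee\neg p$, $\bot:=p\wedge\neg p$ for a fixed $p$. Types: for a finite nonempty set $\Phi=\{\varphi_1,\dots,\varphi_k\}$ and $S\subseteq\{1,\dots,k\}$,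 $\psi_S=\psi_1\wedge\dots\wedge\psi_k$ with $\psi_i=\varphi_i$ if $i\in S$, $\psi_i=\neg\varphi_i$ otherwise; $\mathit{Conj}(\Phi)=\{\psi_S\}$; $\mathit{DNF}(\Phi)=\{\bigvee U:U\subseteq\mathit{Conj}(\Phi)\}$ with $\bigvee\emptyset=\bot$; $\mathit{DNF}(\emptyset)=\{\top,\bot\}$. -}

module Defs where

open import Data.Nat using (ℕ)
open import Data.Bool using (Bool; true)
open import Data.Unit using () renaming (⊤ to Unit)
open import Data.List using (List; []; _∷_; map; _++_)
open import Data.Product using (_×_)
open import Data.Empty using (⊥)
open import Function.Bundles using (_⇔_)
open import Relation.Binary.PropositionalEquality using (_≡_)

Assignment : Set
Assignment = ℕ → Bool

-- an SD-model is a (possibly empty) set of assignments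
SDModel : Set₁
SDModel = Assignment → Set

data Form : Set where
  var  : ℕ → Form
  ¬'_  : Form → Form
  _⇒_  : Form → Form → Form
  D    : List Form → Form → Form

infixr 5 _⇒_

mutual
  _,_⊨_ : SDModel → Assignment → Form → Set
  W , w ⊨ var p = w p ≡ true
  W , w ⊨ (¬' φ) = (W , w ⊨ φ) → ⊥
  W , w ⊨ (φ ⇒ ψ) = (W , w ⊨ φ) → (W , w ⊨ ψ)
  W , w ⊨ D φs ψ = ∀ (u v : Assignment) → W u → W v →
                   Agree W u v φs → ((W , u ⊨ ψ) ⇔ (W , v ⊨ ψ))

  Agree : SDModel → Assignment → Assignment → List Form → Set
  Agree W u v [] = Unit
  Agree W u v (φ ∷ φs) = ((W , u ⊨ φ) ⇔ (W , v ⊨ φ)) × Agree W u v φs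

_∧'_ : Form → Form → Form
φ ∧' ψ = ¬' (φ ⇒ ¬' ψ)

_∨'_ : Form → Form → Form
φ ∨' ψ = (¬' φ) ⇒ ψ

_⇔'_ : Form → Form → Form
φ ⇔' ψ = (φ ⇒ ψ) ∧' (ψ ⇒ φ)

p₀ : Form
p₀ = var 0

⊤' : Form
⊤' = p₀ ∨' (¬' p₀)

⊥' : Form
⊥' = p₀ ∧' (¬' p₀)

C : Form → Form
C ψ = D [] ψ

[u]_ : Form → Form
[u] φ = φ ∧' C φ

-- ψ₁ ∧ … ∧ ψₖ (k ≥ 1); the empty case is never used below
⋀ : List Form → Form
⋀ [] = ⊤'
⋀ (φ ∷ []) = φ
⋀ (φ ∷ ψ ∷ φs) = φ ∧' ⋀ (ψ ∷ φs)

⋁ : List Form → Form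
⋁ [] = ⊥'
⋁ (φ ∷ []) = φ
⋁ (φ ∷ ψ ∷ φs) = φ ∨' ⋁ (ψ ∷ φs)

literals : List Form → List (List Form)
literals [] = [] ∷ []
literals (φ ∷ φs) = map (φ ∷_) (literals φs) ++ map ((¬' φ) ∷_) (literals φs)

Conj : List Form → List Form
Conj φs = map ⋀ (literals φs)

subsets : {A : Set} → List A → List (List A)
subsets [] = [] ∷ []
subsets (x ∷ xs) = map (x ∷_) (subsets xs) ++ subsets xs

DNF : List Form → List Form
DNF [] = ⊤' ∷ ⊥' ∷ []
DNF (φ ∷ φs) = map ⋁ (subsets (Conj (φ ∷ φs)))

D-rhs : List Form → Form → Form
D-rhs φs ψ = ⋁ (map (λ χ → [u] (χ ⇔' ψ)) (DNF φs))

-- Call a conjunction of literals over φ₁,…,φₖ a type. In an SD-model every world realises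
-- exactly one type, and two worlds agree on all φᵢ iff they realise a common type. Hence
-- D(φ₁,…,φₖ;ψ) says that the truth of ψ is a function of the type of a world, i.e. that ψ
-- is equivalent on all of W to the disjunction of the types realised together with ψ;
-- conversely, a formula of DNF(Φ) is a function of the type, and so is every ψ that is
-- equivalent to one on all of W. Classical logic is needed because ∧, ∨ and ↔ are encoded
-- with ¬ and →.
module Submission where

open import Defs
open import Level using (0ℓ)
open import Axiom.ExcludedMiddle using (ExcludedMiddle)
open import Data.Empty using (⊥-elim)
open import Data.Unit using (tt)
open import Data.Product using (∃-syntax; _×_; _,_)
open import Data.Sum using (_⊎_; inj₁; inj₂)
import Data.Sum as Sum
open import Data.List using (List; []; _∷_; map; filter)
open import Data.List.Relation.Unary.All using (All; []; _∷_)
import Data.List.Relation.Unary.All as All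
open import Data.List.Relation.Unary.Any using (Any; here; there)
import Data.List.Relation.Unary.Any as Any
import Data.List.Relation.Unary.Any.Properties as Any
open import Data.List.Membership.Propositional using (_∈_; find; lose)
open import Data.List.Membership.Propositional.Properties
  using (∈-map⁺; ∈-map⁻; ∈-++⁺ˡ; ∈-++⁺ʳ; ∈-++⁻; ∈-filter⁺; ∈-filter⁻)
open import Data.List.Relation.Binary.Sublist.Propositional using (_⊆_; []; _∷_; _∷ʳ_; lookup)
open import Data.List.Relation.Binary.Sublist.Propositional.Properties using (filter-⊆)
open import Function.Bundles using (_⇔_; mk⇔; Equivalence)
import Function.Properties.Equivalence as ⇔
open import Relation.Nullary using (yes; no)
open import Relation.Nullary.Decidable using (decidable-stable)
open import Relation.Binary.PropositionalEquality using (_≡_; refl)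

open Equivalence

∈-subsets⁺ : {A : Set} {xs ys : List A} → ys ⊆ xs → ys ∈ subsets xs
∈-subsets⁺ []                         = here refl
∈-subsets⁺ (refl ∷ ys⊆xs)             = ∈-++⁺ˡ (∈-map⁺ _ (∈-subsets⁺ ys⊆xs))
∈-subsets⁺ {xs = x ∷ xs} (_ ∷ʳ ys⊆xs) = ∈-++⁺ʳ (map (x ∷_) (subsets xs)) (∈-subsets⁺ ys⊆xs)

∈-subsets⁻ : {A : Set} (xs : List A) {ys : List A} → ys ∈ subsets xs → ys ⊆ xs
∈-subsets⁻ [] (here refl) = []
∈-subsets⁻ (x ∷ xs) ys∈ with ∈-++⁻ (map (x ∷_) (subsets xs)) ys∈
... | inj₂ ys∈′ = x ∷ʳ ∈-subsets⁻ xs ys∈′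
... | inj₁ x∷ys∈ with ∈-map⁻ (x ∷_) x∷ys∈
...   | _ , ys∈′ , refl = refl ∷ ∈-subsets⁻ xs ys∈′

data LiteralsOf : List Form → List Form → Set where
  []  : LiteralsOf [] []
  pos : ∀ {φ φs ls} → LiteralsOf φs ls → LiteralsOf (φ ∷ φs) (φ ∷ ls)
  neg : ∀ {φ φs ls} → LiteralsOf φs ls → LiteralsOf (φ ∷ φs) ((¬' φ) ∷ ls)

∈-literals⁺ : ∀ {Φ ls} → LiteralsOf Φ ls → ls ∈ literals Φ
∈-literals⁺ []                = here refl
∈-literals⁺ (pos ls)          = ∈-++⁺ˡ (∈-map⁺ _ (∈-literals⁺ ls))
∈-literals⁺ {φ ∷ φs} (neg ls) = ∈-++⁺ʳ (map (φ ∷_) (literals φs)) (∈-map⁺ _ (∈-literals⁺ ls))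

∈-literals⁻ : ∀ Φ {ls} → ls ∈ literals Φ → LiteralsOf Φ ls
∈-literals⁻ [] (here refl) = []
∈-literals⁻ (φ ∷ φs) ls∈ with ∈-++⁻ (map (φ ∷_) (literals φs)) ls∈
... | inj₁ ls∈′ with ∈-map⁻ (φ ∷_) ls∈′
...   | _ , ls∈″ , refl = pos (∈-literals⁻ φs ls∈″)
∈-literals⁻ (φ ∷ φs) ls∈ | inj₂ ls∈′ with ∈-map⁻ ((¬' φ) ∷_) ls∈′
...   | _ , ls∈″ , refl = neg (∈-literals⁻ φs ls∈″)

-- Conj [] is ⊤' ∷ [], whose two sublists yield exactly the special case DNF [] = ⊤' ∷ ⊥' ∷ [].
∈-DNF⁺ : ∀ Φ {U} → U ⊆ Conj Φ → ⋁ U ∈ DNF Φ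
∈-DNF⁺ [] (refl ∷ []) = here refl
∈-DNF⁺ [] (_ ∷ʳ [])   = there (here refl)
∈-DNF⁺ (φ ∷ φs) U⊆    = ∈-map⁺ ⋁ (∈-subsets⁺ U⊆)

∈-DNF⁻ : ∀ Φ {χ} → χ ∈ DNF Φ → ∃[ U ] U ⊆ Conj Φ × χ ≡ ⋁ U
∈-DNF⁻ [] (here refl)         = ⊤' ∷ [] , refl ∷ [] , refl
∈-DNF⁻ [] (there (here refl)) = [] , _ ∷ʳ [] , refl
∈-DNF⁻ (φ ∷ φs) χ∈ with ∈-map⁻ ⋁ χ∈
... | U , U∈ , refl = U , ∈-subsets⁻ (Conj (φ ∷ φs)) U∈ , refl

module Classical (lem : ExcludedMiddle 0ℓ) (W : SDModel) where

  ⊨-∧ : ∀ {u} a b → W , u ⊨ (a ∧' b) ⇔ (W , u ⊨ a × W , u ⊨ b)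
  ⊨-∧ a b = mk⇔
    (λ h → decidable-stable lem (λ ¬a → h (λ a → ⊥-elim (¬a a)))
         , decidable-stable lem (λ ¬b → h (λ _ → ¬b)))
    (λ (x , y) x⇒¬y → x⇒¬y x y)

  ⊨-∨ : ∀ {u} a b → W , u ⊨ (a ∨' b) ⇔ (W , u ⊨ a ⊎ W , u ⊨ b)
  ⊨-∨ {u} a b = mk⇔ elim λ { (inj₁ x) ¬x → ⊥-elim (¬x x) ; (inj₂ y) _ → y }
    where
    elim : W , u ⊨ (a ∨' b) → W , u ⊨ a ⊎ W , u ⊨ b
    elim h with lem {W , u ⊨ a}
    ... | yes x = inj₁ x
    ... | no ¬x = inj₂ (h ¬x)

  ⊨-⇔ : ∀ {u} a b → W , u ⊨ (a ⇔' b) ⇔ (W , u ⊨ a ⇔ W , u ⊨ b)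
  ⊨-⇔ a b = mk⇔
    (λ h → let (a⇒b , b⇒a) = to (⊨-∧ (a ⇒ b) (b ⇒ a)) h in mk⇔ a⇒b b⇒a)
    (λ a⇔b → from (⊨-∧ (a ⇒ b) (b ⇒ a)) (to a⇔b , from a⇔b))

  ⊨-⋀ : ∀ {u} L → W , u ⊨ ⋀ L ⇔ All (W , u ⊨_) L
  ⊨-⋀ []              = mk⇔ (λ _ → []) (λ _ p → p)
  ⊨-⋀ (φ ∷ [])        = mk⇔ (_∷ []) (λ { (p ∷ []) → p })
  ⊨-⋀ (φ ∷ L@(_ ∷ _)) = mk⇔
    (λ h → let (p , ps) = to (⊨-∧ φ (⋀ L)) h in p ∷ to (⊨-⋀ L) ps)
    (λ ps → from (⊨-∧ φ (⋀ L)) (All.head ps , from (⊨-⋀ L) (All.tail ps)))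

  ⊨-⋁ : ∀ {u} L → W , u ⊨ ⋁ L ⇔ Any (W , u ⊨_) L
  ⊨-⋁ []              = mk⇔ (λ h → ⊥-elim (h (λ p ¬p → ¬p p))) λ ()
  ⊨-⋁ (φ ∷ [])        = mk⇔ here (λ { (here p) → p ; (there ()) })
  ⊨-⋁ (φ ∷ L@(_ ∷ _)) = mk⇔
    (λ h → Any.fromSum (Sum.map₂ (to (⊨-⋁ L)) (to (⊨-∨ φ (⋁ L)) h)))
    (λ ps → from (⊨-∨ φ (⋁ L)) (Sum.map₂ (from (⊨-⋁ L)) (Any.toSum ps)))

  Valid : Form → Set
  Valid θ = ∀ u → W u → W , u ⊨ θ

  ⊨-[u] : ∀ {w} θ → W w → W , w ⊨ ([u] θ) ⇔ Valid θ
  ⊨-[u] {w} θ Ww = mk⇔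
    (λ h → let (θw , θconst) = to (⊨-∧ θ (C θ)) h in λ u Wu → from (θconst u w Wu Ww tt) θw)
    (λ θ-valid → from (⊨-∧ θ (C θ))
      (θ-valid w Ww , λ u v Wu Wv _ → mk⇔ (λ _ → θ-valid v Wv) (λ _ → θ-valid u Wu)))

  Agree-sym : ∀ {u v} Φ → Agree W u v Φ → Agree W v u Φ
  Agree-sym []      _          = tt
  Agree-sym (φ ∷ Φ) (φ⇔ , agr) = ⇔.sym φ⇔ , Agree-sym Φ agr

  Realises : Assignment → List Form → Set
  Realises u ls = All (W , u ⊨_) ls

  literals-exhaustive : ∀ v Φ → ∃[ ls ] LiteralsOf Φ ls × Realises v ls
  literals-exhaustive v [] = [] , [] , []
  literals-exhaustive v (φ ∷ Φ) with literals-exhaustive v Φ | lem {W , v ⊨ φ}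
  ... | ls , lits , real | yes φv = φ ∷ ls , pos lits , φv ∷ real
  ... | ls , lits , real | no ¬φv = (¬' φ) ∷ ls , neg lits , ¬φv ∷ real

  common-literals⇒Agree : ∀ {u v Φ ls} →
    LiteralsOf Φ ls → Realises u ls → Realises v ls → Agree W u v Φ
  common-literals⇒Agree []         []         []         = tt
  common-literals⇒Agree (pos lits) (φu ∷ us)  (φv ∷ vs)  =
    mk⇔ (λ _ → φv) (λ _ → φu) , common-literals⇒Agree lits us vs
  common-literals⇒Agree (neg lits) (¬φu ∷ us) (¬φv ∷ vs) =
    mk⇔ (λ φu → ⊥-elim (¬φu φu)) (λ φv → ⊥-elim (¬φv φv)) , common-literals⇒Agree lits us vs

  Agree⇒literals-transfer : ∀ {u v Φ ls} →
    LiteralsOf Φ ls → Agree W u v Φ → Realises u ls → Realises v ls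
  Agree⇒literals-transfer []         _          []         = []
  Agree⇒literals-transfer (pos lits) (φ⇔ , agr) (φu ∷ us)  =
    to φ⇔ φu ∷ Agree⇒literals-transfer lits agr us
  Agree⇒literals-transfer (neg lits) (φ⇔ , agr) (¬φu ∷ us) =
    (λ φv → ¬φu (from φ⇔ φv)) ∷ Agree⇒literals-transfer lits agr us

  Conj-exhaustive : ∀ v Φ → ∃[ c ] c ∈ Conj Φ × W , v ⊨ c
  Conj-exhaustive v Φ =
    let (ls , lits , real) = literals-exhaustive v Φ
    in ⋀ ls , ∈-map⁺ ⋀ (∈-literals⁺ lits) , from (⊨-⋀ ls) real

  common-Conj⇒Agree : ∀ {u v c} Φ → c ∈ Conj Φ → W , u ⊨ c → W , v ⊨ c → Agree W u v Φ
  common-Conj⇒Agree Φ c∈ cu cv with ∈-map⁻ ⋀ c∈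
  ... | ls , ls∈ , refl =
    common-literals⇒Agree (∈-literals⁻ Φ ls∈) (to (⊨-⋀ ls) cu) (to (⊨-⋀ ls) cv)

  Agree⇒Conj-transfer : ∀ {u v c} Φ → c ∈ Conj Φ → Agree W u v Φ → W , u ⊨ c → W , v ⊨ c
  Agree⇒Conj-transfer Φ c∈ agr cu with ∈-map⁻ ⋀ c∈
  ... | ls , ls∈ , refl =
    from (⊨-⋀ ls) (Agree⇒literals-transfer (∈-literals⁻ Φ ls∈) agr (to (⊨-⋀ ls) cu))

  Agree⇒DNF-transfer : ∀ {u v χ} Φ → χ ∈ DNF Φ → Agree W u v Φ → W , u ⊨ χ → W , v ⊨ χ
  Agree⇒DNF-transfer Φ χ∈ agr χu with ∈-DNF⁻ Φ χ∈
  ... | U , U⊆ , refl =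
    let (c , c∈U , cu) = find (to (⊨-⋁ U) χu)
    in from (⊨-⋁ U) (lose c∈U (Agree⇒Conj-transfer Φ (lookup U⊆ c∈U) agr cu))

  Equivalent : Form → Form → Set
  Equivalent χ ψ = ∀ v → W v → W , v ⊨ χ ⇔ W , v ⊨ ψ

  module _ (Φ : List Form) (ψ : Form) where

    RealisedWith-ψ : Form → Set
    RealisedWith-ψ c = ∃[ u ] W u × W , u ⊨ c × W , u ⊨ ψ

    ψ-types : List Form
    ψ-types = filter (λ c → lem {RealisedWith-ψ c}) (Conj Φ)

    ⊨-D⇒Equivalent-ψ-types : ∀ w → W , w ⊨ D Φ ψ → Equivalent (⋁ ψ-types) ψ
    ⊨-D⇒Equivalent-ψ-types _ ψ-determined v Wv = mk⇔ ψ-types⇒ψ ψ⇒ψ-types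
      where
      ψ-types⇒ψ : W , v ⊨ ⋁ ψ-types → W , v ⊨ ψ
      ψ-types⇒ψ h with find (to (⊨-⋁ ψ-types) h)
      ... | c , c∈ , cv with ∈-filter⁻ (λ c → lem {RealisedWith-ψ c}) c∈
      ...   | c∈Conj , u , Wu , cu , ψu =
        to (ψ-determined u v Wu Wv (common-Conj⇒Agree Φ c∈Conj cu cv)) ψu

      ψ⇒ψ-types : W , v ⊨ ψ → W , v ⊨ ⋁ ψ-types
      ψ⇒ψ-types ψv =
        let (c , c∈Conj , cv) = Conj-exhaustive v Φ
            c∈ = ∈-filter⁺ (λ c → lem {RealisedWith-ψ c}) c∈Conj (v , Wv , cv , ψv)
        in from (⊨-⋁ ψ-types) (lose c∈ cv)

    Equivalent-DNF⇒⊨-D : ∀ w {χ} → χ ∈ DNF Φ → Equivalent χ ψ → W , w ⊨ D Φ ψ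
    Equivalent-DNF⇒⊨-D _ χ∈ χ⇔ψ u v Wu Wv agr = mk⇔
      (λ ψu → to (χ⇔ψ v Wv) (Agree⇒DNF-transfer Φ χ∈ agr (from (χ⇔ψ u Wu) ψu)))
      (λ ψv → to (χ⇔ψ u Wu) (Agree⇒DNF-transfer Φ χ∈ (Agree-sym Φ agr) (from (χ⇔ψ v Wv) ψv)))

    ⊨-D⇔Equivalent-DNF : ∀ w → W , w ⊨ D Φ ψ ⇔ Any (λ χ → Equivalent χ ψ) (DNF Φ)
    ⊨-D⇔Equivalent-DNF w = mk⇔
      (λ ψ-determined →
        lose (∈-DNF⁺ Φ (filter-⊆ (λ c → lem {RealisedWith-ψ c}) (Conj Φ)))
             (⊨-D⇒Equivalent-ψ-types w ψ-determined))
      (λ χ-exists → let (χ , χ∈ , χ⇔ψ) = find χ-exists in Equivalent-DNF⇒⊨-D w χ∈ χ⇔ψ)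

    ⊨-D-rhs⇔Equivalent-DNF : ∀ {w} → W w →
      W , w ⊨ D-rhs Φ ψ ⇔ Any (λ χ → Equivalent χ ψ) (DNF Φ)
    ⊨-D-rhs⇔Equivalent-DNF {w} Ww = mk⇔
      (λ h → Any.map (to disjunct⇔) (Any.map⁻ (to (⊨-⋁ (map disjunct (DNF Φ))) h)))
      (λ χ-exists → from (⊨-⋁ (map disjunct (DNF Φ))) (Any.map⁺ (Any.map (from disjunct⇔) χ-exists)))
      where
      disjunct : Form → Form
      disjunct χ = [u] (χ ⇔' ψ)

      disjunct⇔ : ∀ {χ} → W , w ⊨ disjunct χ ⇔ Equivalent χ ψ
      disjunct⇔ {χ} = mk⇔
        (λ h v Wv → to (⊨-⇔ χ ψ) (to (⊨-[u] (χ ⇔' ψ) Ww) h v Wv))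
        (λ χ⇔ψ → from (⊨-[u] (χ ⇔' ψ) Ww) (λ v Wv → from (⊨-⇔ χ ψ) (χ⇔ψ v Wv)))

proposition3p3 : ExcludedMiddle 0ℓ →
    (φs : List Form) (ψ : Form) (W : SDModel) (w : Assignment) → W w →
    ((W , w ⊨ D φs ψ) ⇔ (W , w ⊨ D-rhs φs ψ))
proposition3p3 lem φs ψ W w Ww =
  ⇔.trans (⊨-D⇔Equivalent-DNF φs ψ w) (⇔.sym (⊨-D-rhs⇔Equivalent-DNF φs ψ Ww))
  where open Classical lem W
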